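{- Let $b \in \mathbb{Z}\setminus\{ -1,0,1\}$ and let $D$ be a $b$-digital semigroup. Then $L_b(D)\cup\{0\}$ is a numerical monoid provided that one of the following conditions holds: (i) $L_b(D)$ is closed under addition; (ii) $b \ge 3$; (iii) $b = 2$ and $2\cdot \min(L_2(D)) \in L_2(D)$; (iv) for all $n, m \in \mathbb{N}$, if $b^n \in D$ and $b^m \in D$ then $b^{n+m+1} \in D$.
   Context: Fix $b \in \mathbb{Z}\setminus\{ -1,0,1\}$ and let $N_b := \{0,1,\dots,|b|-1\}$. Put $Z_b := \mathbb{N}\setminus\{0\}$ if $b>0$ and $Z_b := \mathbb{Z}\setminus\{0\}$ if $b<0$ (here $\mathbb{N}=\{0,1,2,\dots\}$). Every $z \in Z_b$ has a unique representation $z=\sum_{i=0}^{n} u_i b^i$ with $u_0,\dots,u_n \in N_b$, $u_n \neq 0$; its length is $\ell_b(z) := n+1$, and $\ell_b(0):=1$. For $n \ge 1$ let $\Delta_b(n) := \{z \in Z_b : \ell_b(z)=n\}$. For $A \subseteq Z_b$ let $L_b(A) := \{\ell_b(a) : a \in A\}$. A $b$-digital semigroup is a (nonempty) subsemigroup $D$ of the multiplicative semigroup $(Z_b,\cdot)$ such that $\Delta_b(\ell_b(d)) \subseteq D$ for every $d \in D$. A numerical monoid is a submonoid of $(\mathbb{N},+)$ whose complement in $\mathbb{N}$ is finite. -}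

module Defs where

open import Data.Nat using (ℕ; zero; suc) renaming (_+_ to _+ℕ_; _≤_ to _≤ℕ_; _<_ to _<ℕ_)
open import Data.Integer using (ℤ; +_; _+_; _*_; ∣_∣; _<_)
open import Data.List using (List; []; _∷_; length)
open import Data.List.Relation.Unary.All using (All)
open import Data.Product using (Σ; ∃; _×_)
open import Data.Empty using (⊥)
open import Relation.Binary.PropositionalEquality using (_≡_; _≢_)
open import Relation.Nullary using (¬_)

InZ : ℤ → ℤ → Set
InZ b z = ((+ 0 < b) × (+ 0 < z)) Data.Sum.⊎ ((b < + 0) × (z ≢ + 0))
  where import Data.Sum

-- value of a digit list u₀ ∷ u₁ ∷ … ∷ uₙ, i.e. Σ uᵢ bⁱ (Horner form)
evalDigits : ℤ → List ℕ → ℤ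
evalDigits b []       = + 0
evalDigits b (u ∷ us) = + u + b * evalDigits b us

LastNonZero : List ℕ → Set
LastNonZero []           = ⊥
LastNonZero (u ∷ [])     = u ≢ 0
LastNonZero (u ∷ v ∷ us) = LastNonZero (v ∷ us)

-- ℓ_b(z) = k : z = Σ_{i=0}^{k-1} uᵢ bⁱ with uᵢ ∈ N_b = {0,…,|b|-1}, u_{k-1} ≠ 0
-- (the representation is unique, so this relation defines ℓ_b on Z_b)
HasLength : ℤ → ℤ → ℕ → Set
HasLength b z k =
  Σ (List ℕ) λ us →
    All (λ u → u <ℕ ∣ b ∣) us × LastNonZero us × evalDigits b us ≡ z × length us ≡ k

record DigitalSemigroup (b : ℤ) (D : ℤ → Set) : Set where
  field
    subset    : ∀ z → D z → InZ b z
    nonempty  : ∃ λ z → D z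
    mul-closed : ∀ x y → D x → D y → D (x * y)
    length-closed : ∀ d z k → D d → HasLength b d k → InZ b z → HasLength b z k → D z

Lb : ℤ → (ℤ → Set) → ℕ → Set
Lb b D k = ∃ λ d → D d × HasLength b d k

record NumericalMonoid (S : ℕ → Set) : Set where
  field
    has-zero  : S 0
    add-closed : ∀ m n → S m → S n → S (m +ℕ n)
    cofinite  : ∃ λ N → ∀ n → N ≤ℕ n → S n

{-# OPTIONS --safe #-}
-- D contains every number of the same length as one of its elements, and multiplying by
-- b ^ p prepends p zero digits. Hence if k₁ + p and k₂ + q are lengths of elements of D and
-- e₁, e₂, e₁ e₂ have lengths k₁, k₂, k₃, then b ^ p e₁ and b ^ q e₂ lie in D, and so does
-- their product, of length k₃ + p + q. With e₁ = e₂ = 1 this puts 2k - 1 in L = L_b(D) for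
-- every k ∈ L. Each of (ii)-(iv) makes L closed under addition: for b ≥ 3 and b = 2 take
-- e₁ = e₂ = e with ℓ(e²) = 2 ℓ(e) (for b = 2 this needs lengths ≥ 2; if 1 ∈ L, then (iii)
-- gives 2 ∈ L, so 1, b ∈ D and all powers of b lie in D), for (iv) use powers of b directly.
-- Then 2k ∈ L as well, and a submonoid of ℕ containing two consecutive numbers a, a + 1
-- contains every n ≥ a².
module Submission where

open import Defs
open import Data.Nat
  using (ℕ; zero; suc; _≤_; _<_; z≤n; s≤s; _<?_; _≤?_; NonZero; ≢-nonZero)
  renaming (_+_ to _+ℕ_; _*_ to _*ℕ_)
import Data.Nat.Properties as ℕP
import Data.Nat.Tactic.RingSolver as ℕSolver
open import Data.Nat.DivMod using (_/_; _%_; m≡m%n+[m/n]*n; m%n<n; m*n/n≡m; /-monoˡ-≤)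
open import Data.Integer as ℤ
  using (ℤ; +_; -[1+_]; ∣_∣; _^_; _+_; _*_; -_; +≤+; +<+; -<+)
  renaming (_≤_ to _≤ℤ_)
import Data.Integer.Properties as ℤP
open import Data.Integer.Tactic.RingSolver using (solve-∀)
open import Data.List using (List; []; _∷_; length; replicate; _++_)
open import Data.List.Properties using (length-++; length-replicate)
open import Data.List.Relation.Unary.All using (All; []; _∷_)
open import Data.List.Relation.Unary.All.Properties using (++⁺; replicate⁺)
open import Data.Product using (∃; _×_; _,_; uncurry)
open import Data.Sum using (_⊎_; inj₁; inj₂; [_,_]′)
open import Data.Empty using (⊥-elim)
open import Function using (id; _∘_)
open import Relation.Nullary using (yes; no)
open import Relation.Binary.PropositionalEquality

private
  variable
    b z e₁ e₂ : ℤ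
    k k₁ k₂ k₃ p q : ℕ
    us : List ℕ

Digits : ℤ → List ℕ → Set
Digits b = All (_< ∣ b ∣)

evalDigits-singleton : ∀ b u → evalDigits b (u ∷ []) ≡ + u
evalDigits-singleton b u = trans (cong (_+_ (+ u)) (ℤP.*-zeroʳ b)) (ℤP.+-identityʳ (+ u))

evalDigits-≢0 : ∀ b → Digits b us → LastNonZero us → evalDigits b us ≢ + 0
evalDigits-≢0 {us = u ∷ []} b _ u≢0 eq = u≢0 (cong ∣_∣ (trans (sym (evalDigits-singleton b u)) eq))
evalDigits-≢0 {us = u ∷ us@(_ ∷ _)} b (u<∣b∣ ∷ ds) lnz eq = ℕP.<⇒≱ u<∣b∣ ∣b∣≤u
  where
  open ℕP.≤-Reasoning
  e = evalDigits b us
  instance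
    ∣e∣-nonZero : NonZero ∣ e ∣
    ∣e∣-nonZero = ≢-nonZero (evalDigits-≢0 b ds lnz ∘ ℤP.∣i∣≡0⇒i≡0)
  u≡-be : + u ≡ - (b * e)
  u≡-be = ℤP.i-j≡0⇒i≡j (+ u) (- (b * e)) (trans (cong (_+_ (+ u)) (ℤP.neg-involutive (b * e))) eq)
  ∣b∣≤u : ∣ b ∣ ≤ u
  ∣b∣≤u = begin
    ∣ b ∣             ≤⟨ ℕP.m≤m*n ∣ b ∣ ∣ e ∣ ⟩
    ∣ b ∣ *ℕ ∣ e ∣    ≡⟨ ℤP.abs-* b e ⟨
    ∣ b * e ∣         ≡⟨ ℤP.∣-i∣≡∣i∣ (b * e) ⟨
    ∣ - (b * e) ∣     ≡⟨ cong ∣_∣ u≡-be ⟨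
    u                 ∎

evalDigits-natural : ∀ B us → ∃ λ n → evalDigits (+ B) us ≡ + n
evalDigits-natural B [] = 0 , refl
evalDigits-natural B (u ∷ us) with evalDigits-natural B us
... | n , eq = u +ℕ B *ℕ n , trans (cong (λ e → + u + + B * e) eq) (cong (_+_ (+ u)) (sym (ℤP.pos-* B n)))

HasLength⇒InZ : 2 ≤ ∣ b ∣ → HasLength b z k → InZ b z
HasLength⇒InZ {+ zero} () _
HasLength⇒InZ {+ suc B} _ (us , ds , lnz , refl , _) with evalDigits-natural (suc B) us
... | zero  , eq = ⊥-elim (evalDigits-≢0 (+ suc B) ds lnz eq)
... | suc n , eq = inj₁ (+<+ (s≤s z≤n) , subst (+ 0 ℤ.<_) (sym eq) (+<+ (s≤s z≤n)))
HasLength⇒InZ { -[1+ B ]} _ (us , ds , lnz , refl , _) = inj₂ (-<+ , evalDigits-≢0 -[1+ B ] ds lnz)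

HasLength-suc : HasLength b z k → ∃ λ p → k ≡ suc p
HasLength-suc (_ ∷ us , _ , _ , _ , refl) = length us , refl

LastNonZero-∷ : ∀ u us → LastNonZero us → LastNonZero (u ∷ us)
LastNonZero-∷ u (_ ∷ _) lnz = lnz

LastNonZero-shift : ∀ p us → LastNonZero us → LastNonZero (replicate p 0 ++ us)
LastNonZero-shift zero    us lnz = lnz
LastNonZero-shift (suc p) us lnz = LastNonZero-∷ 0 (replicate p 0 ++ us) (LastNonZero-shift p us lnz)

evalDigits-shift : ∀ b p us → evalDigits b (replicate p 0 ++ us) ≡ b ^ p * evalDigits b us
evalDigits-shift b zero    us = sym (ℤP.*-identityˡ (evalDigits b us))
evalDigits-shift b (suc p) us = begin
  + 0 + b * evalDigits b (replicate p 0 ++ us) ≡⟨ ℤP.+-identityˡ _ ⟩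
  b * evalDigits b (replicate p 0 ++ us)       ≡⟨ cong (b *_) (evalDigits-shift b p us) ⟩
  b * (b ^ p * evalDigits b us)                ≡⟨ ℤP.*-assoc b (b ^ p) _ ⟨
  b ^ suc p * evalDigits b us                  ∎
  where open ≡-Reasoning

HasLength-shift : 2 ≤ ∣ b ∣ → ∀ p → HasLength b z k → HasLength b (b ^ p * z) (k +ℕ p)
HasLength-shift {b} hb p (us , ds , lnz , refl , refl) =
  replicate p 0 ++ us ,
  ++⁺ (replicate⁺ p (ℕP.<-≤-trans (s≤s z≤n) hb)) ds ,
  LastNonZero-shift p us lnz ,
  evalDigits-shift b p us ,
  trans (length-++ (replicate p 0)) (trans (cong (_+ℕ length us) (length-replicate p)) (ℕP.+-comm p (length us)))

HasLength-one : 2 ≤ ∣ b ∣ → HasLength b (+ 1) 1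
HasLength-one {b} hb = 1 ∷ [] , hb ∷ [] , (λ ()) , evalDigits-singleton b 1 , refl

HasLength-^ : 2 ≤ ∣ b ∣ → ∀ p → HasLength b (b ^ p) (suc p)
HasLength-^ {b} hb p =
  subst (λ x → HasLength b x (suc p)) (ℤP.*-identityʳ (b ^ p)) (HasLength-shift hb p (HasLength-one hb))

Expansion : ℤ → ℤ → Set
Expansion b z = ∃ λ us → Digits b us × evalDigits b us ≡ z

consTrimmed : ℕ → List ℕ → List ℕ
consTrimmed u     (v ∷ vs) = u ∷ v ∷ vs
consTrimmed zero  []       = []
consTrimmed (suc u) []     = suc u ∷ []

trim : List ℕ → List ℕ
trim []       = []
trim (u ∷ us) = consTrimmed u (trim us)

evalDigits-consTrimmed : ∀ b u us → evalDigits b (consTrimmed u us) ≡ evalDigits b (u ∷ us)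
evalDigits-consTrimmed b u       (_ ∷ _) = refl
evalDigits-consTrimmed b zero    []      = sym (trans (ℤP.+-identityˡ _) (ℤP.*-zeroʳ b))
evalDigits-consTrimmed b (suc u) []      = refl

evalDigits-trim : ∀ b us → evalDigits b (trim us) ≡ evalDigits b us
evalDigits-trim b []       = refl
evalDigits-trim b (u ∷ us) =
  trans (evalDigits-consTrimmed b u (trim us)) (cong (λ e → + u + b * e) (evalDigits-trim b us))

All-consTrimmed : ∀ {P : ℕ → Set} u us → All P (u ∷ us) → All P (consTrimmed u us)
All-consTrimmed u       (_ ∷ _) pus = pus
All-consTrimmed zero    []      _   = []
All-consTrimmed (suc u) []      pus = pus

All-trim : ∀ {P : ℕ → Set} us → All P us → All P (trim us)
All-trim []       []         = []
All-trim (u ∷ us) (pu ∷ pus) = All-consTrimmed u (trim us) (pu ∷ All-trim us pus)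

trim-LastNonZero : ∀ us → trim us ≡ [] ⊎ LastNonZero (trim us)
trim-LastNonZero []       = inj₁ refl
trim-LastNonZero (u ∷ us) with trim us | trim-LastNonZero us
... | _ ∷ _ | inj₂ lnz = inj₂ lnz
... | []    | _        with u
...   | zero  = inj₁ refl
...   | suc _ = inj₂ (λ ())

Expansion⇒HasLength : Expansion b z → z ≢ + 0 → ∃ (HasLength b z)
Expansion⇒HasLength {b} (us , ds , refl) z≢0
  with trim us | trim-LastNonZero us | evalDigits-trim b us | All-trim us ds
... | []     | _        | eq | _   = ⊥-elim (z≢0 (sym eq))
... | v ∷ vs | inj₂ lnz | eq | ds′ = _ , v ∷ vs , ds′ , lnz , eq , refl

module PositiveBase (B′ : ℕ) where

  private
    B = suc (suc B′)
    base = + B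

  increment : List ℕ → List ℕ
  increment []       = 1 ∷ []
  increment (u ∷ us) with suc u <? B
  ... | yes _ = suc u ∷ us
  ... | no  _ = 0 ∷ increment us

  Digits-increment : Digits base us → Digits base (increment us)
  Digits-increment {[]}     _          = s≤s (s≤s z≤n) ∷ []
  Digits-increment {u ∷ us} (_ ∷ ds) with suc u <? B
  ... | yes u+1<B = u+1<B ∷ ds
  ... | no  _     = s≤s z≤n ∷ Digits-increment ds

  evalDigits-increment : Digits base us → evalDigits base (increment us) ≡ + 1 + evalDigits base us
  evalDigits-increment {[]}     _ = evalDigits-singleton base 1
  evalDigits-increment {u ∷ us} (u<B ∷ ds) with suc u <? B
  ... | yes _    = ℤP.+-assoc (+ 1) (+ u) (base * evalDigits base us)
  ... | no u+1≮B with ℕP.≤-antisym u<B (ℕP.≮⇒≥ u+1≮B)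
  ...   | refl =
    trans (cong (λ e → + 0 + base * e) (evalDigits-increment ds)) (carry (+ suc B′) (evalDigits base us))
    where
    carry : ∀ u e → + 0 + (+ 1 + u) * (+ 1 + e) ≡ + 1 + (u + (+ 1 + u) * e)
    carry = solve-∀

  Expansion-suc : Expansion base z → Expansion base (+ 1 + z)
  Expansion-suc (us , ds , refl) = increment us , Digits-increment ds , evalDigits-increment ds

  expansion : ∀ n → Expansion base (+ n)
  expansion zero    = [] , [] , refl
  expansion (suc n) = Expansion-suc (expansion n)

module NegativeBase (B′ : ℕ) where

  private
    B = suc (suc B′)
    base = -[1+ suc B′ ]

  increment decrement : List ℕ → List ℕ
  increment []       = 1 ∷ []
  increment (u ∷ us) with suc u <? B
  ... | yes _ = suc u ∷ us
  ... | no  _ = 0 ∷ decrement us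
  decrement []           = suc B′ ∷ 1 ∷ []
  decrement (zero ∷ us)  = suc B′ ∷ increment us
  decrement (suc u ∷ us) = u ∷ us

  Digits-increment : Digits base us → Digits base (increment us)
  Digits-decrement : Digits base us → Digits base (decrement us)
  Digits-increment {[]}     _          = s≤s (s≤s z≤n) ∷ []
  Digits-increment {u ∷ us} (_ ∷ ds) with suc u <? B
  ... | yes u+1<B = u+1<B ∷ ds
  ... | no  _     = s≤s z≤n ∷ Digits-decrement ds
  Digits-decrement {[]}         _          = ℕP.n<1+n _ ∷ s≤s (s≤s z≤n) ∷ []
  Digits-decrement {zero ∷ us}  (_ ∷ ds)   = ℕP.n<1+n _ ∷ Digits-increment ds
  Digits-decrement {suc u ∷ us} (u<B ∷ ds) = ℕP.<-trans (ℕP.n<1+n u) u<B ∷ ds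

  -- Since base = - B, a carry B · baseⁱ = - baseⁱ⁺¹ is a borrow from the higher digits.
  evalDigits-increment : Digits base us → evalDigits base (increment us) ≡ + 1 + evalDigits base us
  evalDigits-decrement : Digits base us → evalDigits base (decrement us) ≡ -[1+ 0 ] + evalDigits base us
  evalDigits-increment {[]}     _ = evalDigits-singleton base 1
  evalDigits-increment {u ∷ us} (u<B ∷ ds) with suc u <? B
  ... | yes _    = ℤP.+-assoc (+ 1) (+ u) (base * evalDigits base us)
  ... | no u+1≮B with ℕP.≤-antisym u<B (ℕP.≮⇒≥ u+1≮B)
  ...   | refl =
    trans (cong (λ e → + 0 + base * e) (evalDigits-decrement ds)) (carry (+ suc B′) (evalDigits base us))
    where
    carry : ∀ u e → + 0 + - (+ 1 + u) * (-[1+ 0 ] + e) ≡ + 1 + (u + - (+ 1 + u) * e)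
    carry = solve-∀
  evalDigits-decrement {[]} _ = borrow (+ suc B′)
    where
    borrow : ∀ y → y + - (+ 1 + y) * (+ 1 + - (+ 1 + y) * + 0) ≡ -[1+ 0 ] + + 0
    borrow = solve-∀
  evalDigits-decrement {zero ∷ us} (_ ∷ ds) =
    trans (cong (λ e → + suc B′ + base * e) (evalDigits-increment ds)) (borrow (+ suc B′) (evalDigits base us))
    where
    borrow : ∀ y e → y + - (+ 1 + y) * (+ 1 + e) ≡ -[1+ 0 ] + (+ 0 + - (+ 1 + y) * e)
    borrow = solve-∀
  evalDigits-decrement {suc u ∷ us} _ = ℤP.+-assoc -[1+ 0 ] (+ suc u) (base * evalDigits base us)

  Expansion-suc : Expansion base z → Expansion base (+ 1 + z)
  Expansion-suc (us , ds , refl) = increment us , Digits-increment ds , evalDigits-increment ds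

  Expansion-pred : Expansion base z → Expansion base (-[1+ 0 ] + z)
  Expansion-pred (us , ds , refl) = decrement us , Digits-decrement ds , evalDigits-decrement ds

  expansion : ∀ z → Expansion base z
  expansion (+ zero)     = [] , [] , refl
  expansion (+ suc n)    = Expansion-suc (expansion (+ n))
  expansion -[1+ zero ]  = Expansion-pred (expansion (+ 0))
  expansion -[1+ suc n ] = Expansion-pred (expansion -[1+ n ])

InZ⇒HasLength : 2 ≤ ∣ b ∣ → InZ b z → ∃ (HasLength b z)
InZ⇒HasLength {+ suc (suc B′)} {+ suc n} _ _ =
  Expansion⇒HasLength (PositiveBase.expansion B′ (suc n)) (λ ())
InZ⇒HasLength { -[1+ suc B′ ]} {z} _ (inj₂ (_ , z≢0)) =
  Expansion⇒HasLength (NegativeBase.expansion B′ z) z≢0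
InZ⇒HasLength {+ suc (suc _)} {+ zero}   _ (inj₁ (_ , +<+ ()))
InZ⇒HasLength {+ suc (suc _)} {+ zero}   _ (inj₂ (+<+ () , _))
InZ⇒HasLength {+ suc (suc _)} { -[1+ _ ]} _ (inj₁ (_ , ()))
InZ⇒HasLength {+ suc (suc _)} { -[1+ _ ]} _ (inj₂ (+<+ () , _))
InZ⇒HasLength { -[1+ suc _ ]} _ (inj₁ (() , _))
InZ⇒HasLength {+ zero}        ()
InZ⇒HasLength {+ suc zero}    (s≤s ())
InZ⇒HasLength { -[1+ zero ]}  (s≤s ())

AdditivelyClosed : (ℕ → Set) → Set
AdditivelyClosed S = ∀ m n → S m → S n → S (m +ℕ n)

AdditivelyClosed-∪0 : ∀ {S : ℕ → Set} → AdditivelyClosed S → AdditivelyClosed (λ k → k ≡ 0 ⊎ S k)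
AdditivelyClosed-∪0 {S} closed .0 n (inj₁ refl) sn          = sn
AdditivelyClosed-∪0 {S} closed m .0 (inj₂ sm)   (inj₁ refl) = inj₂ (subst S (sym (ℕP.+-identityʳ m)) sm)
AdditivelyClosed-∪0 {S} closed m n  (inj₂ sm)   (inj₂ sn)   = inj₂ (closed m n sm sn)

module _ {S : ℕ → Set} (0∈S : S 0) (closed : AdditivelyClosed S)
         {a : ℕ} .{{_ : NonZero a}} (a∈S : S a) (1+a∈S : S (suc a)) where

  -- k a + j = (k - j) a + j (a + 1)
  k*a+j∈S : ∀ k j → j ≤ k → S (k *ℕ a +ℕ j)
  k*a+j∈S zero    .0 z≤n = 0∈S
  k*a+j∈S (suc k) j  j≤1+k with j ≤? k
  ... | yes j≤k = subst S (sym (ℕP.+-assoc a (k *ℕ a) j)) (closed _ _ a∈S (k*a+j∈S k j j≤k))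
  ... | no  j≰k rewrite ℕP.≤-antisym j≤1+k (ℕP.≰⇒> j≰k) =
    subst S (shuffle a k) (closed _ _ 1+a∈S (k*a+j∈S k k ℕP.≤-refl))
    where
    shuffle : ∀ a k → suc a +ℕ (k *ℕ a +ℕ k) ≡ suc k *ℕ a +ℕ suc k
    shuffle = ℕSolver.solve-∀

  a*a≤n⇒n∈S : ∀ n → a *ℕ a ≤ n → S n
  a*a≤n⇒n∈S n a²≤n = subst S (sym n≡) (k*a+j∈S (n / a) (n % a) n%a≤n/a)
    where
    n≡ : n ≡ n / a *ℕ a +ℕ n % a
    n≡ = trans (m≡m%n+[m/n]*n n a) (ℕP.+-comm (n % a) _)
    n%a≤n/a : n % a ≤ n / a
    n%a≤n/a = ℕP.≤-trans (ℕP.<⇒≤ (m%n<n n a)) (subst (_≤ n / a) (m*n/n≡m a a) (/-monoˡ-≤ a a²≤n))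

  consecutive⇒NumericalMonoid : NumericalMonoid S
  consecutive⇒NumericalMonoid = record
    { has-zero   = 0∈S
    ; add-closed = closed
    ; cofinite   = a *ℕ a , a*a≤n⇒n∈S
    }

SquareWitness : ℤ → ℕ → Set
SquareWitness b k = ∃ λ e → HasLength b e k × HasLength b (e * e) (k +ℕ k)

-- (b - 1)² = 1 + (b - 2) b
SquareWitness-≥3 : + 3 ≤ℤ b → SquareWitness b 1
SquareWitness-≥3 (+≤+ {n = suc (suc (suc B))} (s≤s (s≤s (s≤s _)))) =
  + suc (suc B) ,
  (suc (suc B) ∷ [] , ℕP.n<1+n _ ∷ [] , (λ ()) , evalDigits-singleton (+ suc (suc (suc B))) _ , refl) ,
  (1 ∷ suc B ∷ [] , s≤s (s≤s z≤n) ∷ ℕP.m≤n⇒m≤1+n (ℕP.n<1+n _) ∷ [] , (λ ()) , square (+ B) , refl)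
  where
  square : ∀ x → + 1 + (+ 3 + x) * ((+ 1 + x) + (+ 3 + x) * + 0) ≡ (+ 2 + x) * (+ 2 + x)
  square = solve-∀

-- 3² = 9 = 1001₂
SquareWitness-2 : SquareWitness (+ 2) 2
SquareWitness-2 =
  + 3 ,
  (1 ∷ 1 ∷ [] , ℕP.≤-refl ∷ ℕP.≤-refl ∷ [] , (λ ()) , refl , refl) ,
  (1 ∷ 0 ∷ 0 ∷ 1 ∷ [] , ℕP.≤-refl ∷ s≤s z≤n ∷ s≤s z≤n ∷ ℕP.≤-refl ∷ [] , (λ ()) , refl , refl)

module LengthSet (b : ℤ) (hb : 2 ≤ ∣ b ∣) {D : ℤ → Set} (DS : DigitalSemigroup b D) where

  open DigitalSemigroup DS

  L : ℕ → Set
  L = Lb b D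

  ∈L⇒∈D : ∀ {x} → L k → HasLength b x k → D x
  ∈L⇒∈D {k} {x} (d , d∈D , hd) hx = length-closed d x k d∈D hd (HasLength⇒InZ hb hx) hx

  L-suc : L k → ∃ λ p → k ≡ suc p
  L-suc (_ , _ , hd) = HasLength-suc hd

  L-mul : HasLength b e₁ k₁ → HasLength b e₂ k₂ → HasLength b (e₁ * e₂) k₃ →
          L (k₁ +ℕ p) → L (k₂ +ℕ q) → L (k₃ +ℕ (p +ℕ q))
  L-mul {e₁} {e₂ = e₂} {p = p} {q} h₁ h₂ h₃ L₁ L₂ =
    _ , product∈D , subst (λ x → HasLength b x _) (sym shifted-product) (HasLength-shift hb (p +ℕ q) h₃)
    where
    product∈D : D ((b ^ p * e₁) * (b ^ q * e₂))
    product∈D = mul-closed _ _ (∈L⇒∈D L₁ (HasLength-shift hb p h₁)) (∈L⇒∈D L₂ (HasLength-shift hb q h₂))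
    shifted-product : (b ^ p * e₁) * (b ^ q * e₂) ≡ b ^ (p +ℕ q) * (e₁ * e₂)
    shifted-product = trans (interchange (b ^ p) (b ^ q) e₁ e₂) (cong (_* (e₁ * e₂)) (sym (ℤP.^-distribˡ-+-* b p q)))
      where
      interchange : ∀ x y u v → (x * u) * (y * v) ≡ (x * y) * (u * v)
      interchange = solve-∀

  L-odd : L (suc p) → L (suc (p +ℕ p))
  L-odd Lk = L-mul (HasLength-one hb) (HasLength-one hb) (HasLength-one hb) Lk Lk

  L-+-square : SquareWitness b k → L (k +ℕ p) → L (k +ℕ q) → L ((k +ℕ p) +ℕ (k +ℕ q))
  L-+-square {k} {p} {q} (_ , h , h²) L₁ L₂ = subst L (shuffle k p q) (L-mul h h h² L₁ L₂)
    where
    shuffle : ∀ k p q → (k +ℕ k) +ℕ (p +ℕ q) ≡ (k +ℕ p) +ℕ (k +ℕ q)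
    shuffle = ℕSolver.solve-∀

  1,2∈L⇒suc∈L : L 1 → L 2 → ∀ p → L (suc p)
  1,2∈L⇒suc∈L L₁ L₂ p = b ^ p , b^p∈D p , HasLength-^ hb p
    where
    b∈D : D b
    b∈D = ∈L⇒∈D L₂ (subst (λ x → HasLength b x 2) (ℤP.*-identityʳ b) (HasLength-^ hb 1))
    b^p∈D : ∀ p → D (b ^ p)
    b^p∈D zero    = ∈L⇒∈D L₁ (HasLength-one hb)
    b^p∈D (suc p) = mul-closed _ _ b∈D (b^p∈D p)

  base≥3⇒AdditivelyClosed : + 3 ≤ℤ b → AdditivelyClosed L
  base≥3⇒AdditivelyClosed b≥3 m n Lm Ln with L-suc Lm | L-suc Ln
  ... | _ , refl | _ , refl = L-+-square (SquareWitness-≥3 b≥3) Lm Ln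

  2·min∈L : Set
  2·min∈L = ∃ λ m → (L m × (∀ k → L k → m ≤ k)) × L (2 *ℕ m)

  2·min∈L⇒1∈L⇒suc∈L : 2·min∈L → L 1 → ∀ p → L (suc p)
  2·min∈L⇒1∈L⇒suc∈L (m₀ , (Lm₀ , minimal) , L2m₀) L₁ with L-suc Lm₀ | minimal 1 L₁
  ... | zero  , refl | _     = 1,2∈L⇒suc∈L L₁ L2m₀
  ... | suc _ , refl | s≤s ()

  base2⇒AdditivelyClosed : b ≡ + 2 → 2·min∈L → AdditivelyClosed L
  base2⇒AdditivelyClosed b≡2 min m n Lm Ln with L-suc Lm | L-suc Ln
  ... | zero  , refl | _            = 2·min∈L⇒1∈L⇒suc∈L min Lm n
  ... | suc p , refl | zero  , refl = 2·min∈L⇒1∈L⇒suc∈L min Ln (suc p +ℕ 1)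
  ... | suc p , refl | suc q , refl = L-+-square {p = p} witness Lm Ln
    where
    witness : SquareWitness b 2
    witness = subst (λ c → SquareWitness c 2) (sym b≡2) SquareWitness-2

  powers⇒AdditivelyClosed : (∀ n m → D (b ^ n) → D (b ^ m) → D (b ^ (n +ℕ m +ℕ 1))) → AdditivelyClosed L
  powers⇒AdditivelyClosed powers m n Lm Ln with L-suc Lm | L-suc Ln
  ... | p , refl | q , refl =
    subst L (cong suc (trans (ℕP.+-comm (p +ℕ q) 1) (sym (ℕP.+-suc p q))))
      (_ , powers p q (∈L⇒∈D Lm (HasLength-^ hb p)) (∈L⇒∈D Ln (HasLength-^ hb q)) , HasLength-^ hb (p +ℕ q +ℕ 1))

  AdditivelyClosed⇒NumericalMonoid : AdditivelyClosed L → NumericalMonoid (λ k → k ≡ 0 ⊎ L k)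
  AdditivelyClosed⇒NumericalMonoid closed with nonempty
  ... | d , d∈D with InZ⇒HasLength hb (subset d d∈D)
  ... | k , hd with HasLength-suc hd
  ... | p , refl =
    consecutive⇒NumericalMonoid (inj₁ refl) (AdditivelyClosed-∪0 closed)
      (inj₂ (L-odd Lk)) (inj₂ (subst L (cong suc (ℕP.+-suc p p)) (closed _ _ Lk Lk)))
    where
    Lk : L (suc p)
    Lk = d , d∈D , hd

proposition1p4 : (b : ℤ) → 2 ≤ ∣ b ∣ → (D : ℤ → Set) → DigitalSemigroup b D →
    ((∀ m n → Lb b D m → Lb b D n → Lb b D (m +ℕ n))
    ⊎ (+ 3 ≤ℤ b)
    ⊎ (b ≡ + 2 × ∃ λ m → (Lb b D m × (∀ k → Lb b D k → m ≤ k)) × Lb b D (2 *ℕ m))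
    ⊎ (∀ (n m : ℕ) → D (b ^ n) → D (b ^ m) → D (b ^ (n +ℕ m +ℕ 1)))) →
    NumericalMonoid (λ k → k ≡ 0 ⊎ Lb b D k)
proposition1p4 b hb D DS =
  AdditivelyClosed⇒NumericalMonoid ∘
  [ id , [ base≥3⇒AdditivelyClosed , [ uncurry base2⇒AdditivelyClosed , powers⇒AdditivelyClosed ]′ ]′ ]′
  where open LengthSet b hb DS
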